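{- Let $S\subset\{0,1\}^n$ with $|S|=2^{n-1}$ and $\mathrm{Type}(S)=t$. If $t<2^{n-3}$, then there is a unique half plane $H$ of $Q_n$ with $|S\cap H|=t$, and every half plane $H'\ne H$ satisfies $|S\cap H'|\ge 2^{n-2}-t>2^{n-3}$.
   Context: $Q_n$ is the hypercube on $\{0,1\}^n$. A half plane is a set $\{x\in\{0,1\}^n: x_i=a\}$ for some $1\le i\le n$, $a\in\{0,1\}$. For $S\subset\{0,1\}^n$, $\mathrm{Type}(S)=\min_H|S\cap H|$ over all $2n$ half planes $H$. -}

module Defs where

open import Data.Nat using (ℕ; _≤_)
open import Data.Bool using (Bool)
open import Data.Bool.Properties using () renaming (_≟_ to _≟ᵇ_)
open import Data.Fin using (Fin)
open import Data.Vec using (Vec; lookup)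
open import Data.List using (List; length; filter)
open import Data.Product using (Σ; _×_; _,_)
open import Relation.Binary.PropositionalEquality using (_≡_)

Point : ℕ → Set
Point n = Vec Bool n

-- A half plane {x : x_i = a} is determined by (i , a).
HalfPlane : ℕ → Set
HalfPlane n = Fin n × Bool

inHalf : ∀ {n} → HalfPlane n → Point n → Set
inHalf (i , a) x = lookup x i ≡ a

-- |S ∩ H| for a finite set S represented as a duplicate-free list.
interCard : ∀ {n} → List (Point n) → HalfPlane n → ℕ
interCard S (i , a) = length (filter (λ x → lookup x i ≟ᵇ a) S)

IsType : ∀ {n} → List (Point n) → ℕ → Set
IsType {n} S t =
  Σ (HalfPlane n) (λ H → interCard S H ≡ t) × ((H : HalfPlane n) → t ≤ interCard S H)

module Submission where

-- If H meets S in t points and H' ≠ H is another half plane, then S is covered by H, H' and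
-- the points outside both. Those form the empty set when H' is opposite to H and a subcube of
-- codimension 2 otherwise, so 2^(n-1) = |S| ≤ t + |S ∩ H'| + 2^(n-2). A second half plane
-- meeting S in t points would thus force 2^n ≤ 8t. Subcubes are counted by deleting a fixed
-- coordinate, which is injective on them.

open import Defs
open import Data.Nat using (ℕ; zero; suc; _*_; _+_; _^_; _≤_; _<_; z≤n; s≤s)
open import Data.Nat.Properties
open import Data.Bool using (Bool; true; not)
open import Data.Bool.Properties using (¬-not; not-¬; not-injective) renaming (_≟_ to _≟ᵇ_)
open import Data.Fin using (Fin; punchOut) renaming (zero to fzero)
import Data.Fin.Properties as Fin
open import Data.Vec using (Vec; []; lookup; removeAt; insertAt)
open import Data.Vec.Properties using (insertAt-removeAt; removeAt-punchOut)
open import Data.List using (List; []; _∷_; length; filter; map)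
open import Data.List.Properties using (filter-≐; length-map)
open import Data.List.Relation.Unary.All as All using (All; []; _∷_)
import Data.List.Relation.Unary.All.Properties as All
open import Data.List.Relation.Unary.AllPairs using ([]; _∷_)
open import Data.List.Relation.Unary.Unique.Propositional using (Unique)
import Data.List.Relation.Unary.Unique.Propositional.Properties as Unique
open import Data.List.Relation.Binary.Sublist.Propositional.Properties using (filter-⊆; filter⁺)
open import Data.List.Relation.Binary.Sublist.Heterogeneous.Properties using (length-mono-≤)
open import Data.Product.Properties using (≡-dec)
open import Data.Product using (Σ; _×_; _,_; proj₁)
open import Function using (_∘_)
open import Relation.Binary.PropositionalEquality
open import Relation.Nullary using (¬_; yes; no; contradiction)
open import Relation.Unary using (Decidable; ∁; _≐_)
open import Relation.Unary.Properties using (∁?)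

filter-partition : ∀ {A : Set} {P : A → Set} (P? : Decidable P) (xs : List A) →
  length (filter P? xs) + length (filter (∁? P?) xs) ≡ length xs
filter-partition P? [] = refl
filter-partition P? (x ∷ xs) with P? x
... | yes _ = cong suc (filter-partition P? xs)
... | no _ = trans (+-suc _ _) (cong suc (filter-partition P? xs))

filter-cover : ∀ {A : Set} {P Q : A → Set} (P? : Decidable P) (Q? : Decidable Q) (xs : List A) →
  length xs ≤ length (filter P? xs) + length (filter Q? xs) + length (filter (∁? Q?) (filter (∁? P?) xs))
filter-cover P? Q? xs = begin
  length xs                                 ≡⟨ filter-partition P? xs ⟨
  length (filter P? xs) + length ¬Pxs       ≡⟨ cong (length (filter P? xs) +_) (filter-partition Q? ¬Pxs) ⟨
  length (filter P? xs) + (length (filter Q? ¬Pxs) + length (filter (∁? Q?) ¬Pxs))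
    ≤⟨ +-monoʳ-≤ (length (filter P? xs)) (+-monoˡ-≤ _ Q¬P≤Q) ⟩
  length (filter P? xs) + (length (filter Q? xs) + length (filter (∁? Q?) ¬Pxs))
                                            ≡⟨ +-assoc (length (filter P? xs)) _ _ ⟨
  length (filter P? xs) + length (filter Q? xs) + length (filter (∁? Q?) ¬Pxs) ∎
  where
  open ≤-Reasoning
  ¬Pxs = filter (∁? P?) xs
  Q¬P≤Q : length (filter Q? ¬Pxs) ≤ length (filter Q? xs)
  Q¬P≤Q = length-mono-≤ (filter⁺ Q? Q? (λ { refl q → q }) (filter-⊆ (∁? P?) xs))

unique-map⁺ : ∀ {A B : Set} {P : A → Set} {f : A → B} {xs : List A} →
  (∀ {x y} → P x → P y → f x ≡ f y → x ≡ y) → All P xs → Unique xs → Unique (map f xs)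
unique-map⁺ inj [] [] = []
unique-map⁺ inj (px ∷ pxs) (x∉xs ∷ u) =
  All.map⁺ (All.zipWith (λ (py , x≢y) → x≢y ∘ inj px py) (pxs , x∉xs)) ∷ unique-map⁺ inj pxs u

removeAt-injective : ∀ {A : Set} {n} (x y : Vec A (suc n)) i →
  lookup x i ≡ lookup y i → removeAt x i ≡ removeAt y i → x ≡ y
removeAt-injective x y i xᵢ≡yᵢ x⁻≡y⁻ = begin
  x                                          ≡⟨ insertAt-removeAt x i ⟨
  insertAt (removeAt x i) i (lookup x i)     ≡⟨ cong₂ (λ v c → insertAt v i c) x⁻≡y⁻ xᵢ≡yᵢ ⟩
  insertAt (removeAt y i) i (lookup y i)     ≡⟨ insertAt-removeAt y i ⟩
  y                                          ∎
  where open ≡-Reasoning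

inHalf? : ∀ {n} (H : HalfPlane n) → Decidable (inHalf H)
inHalf? (i , a) x = lookup x i ≟ᵇ a

outside : ∀ {n} → HalfPlane n → HalfPlane n → List (Point n) → List (Point n)
outside H H' S = filter (∁? (inHalf? H')) (filter (∁? (inHalf? H)) S)

removeAt-unique : ∀ {n} (i : Fin (suc n)) a {L : List (Point (suc n))} →
  All (inHalf (i , a)) L → Unique L → Unique (map (λ x → removeAt x i) L)
removeAt-unique i a =
  unique-map⁺ (λ {x} {y} xᵢ≡a yᵢ≡a → removeAt-injective x y i (trans xᵢ≡a (sym yᵢ≡a)))

halfPlane-partition : ∀ {n} (i : Fin n) a (S : List (Point n)) →
  interCard S (i , a) + interCard S (i , not a) ≡ length S
halfPlane-partition i a S = begin
  interCard S (i , a) + interCard S (i , not a)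
    ≡⟨ cong (λ T → interCard S (i , a) + length T) (filter-≐ _ _ ≢a≐≡¬a S) ⟨
  interCard S (i , a) + length (filter (∁? (inHalf? (i , a))) S)
    ≡⟨ filter-partition (inHalf? (i , a)) S ⟩
  length S ∎
  where
  open ≡-Reasoning
  ≢a≐≡¬a : ∁ (inHalf (i , a)) ≐ inHalf (i , not a)
  ≢a≐≡¬a = ¬-not , λ xᵢ≡¬a xᵢ≡a → not-¬ xᵢ≡a xᵢ≡¬a

mutual
  unique-length≤ : ∀ n {L : List (Point n)} → Unique L → length L ≤ 2 ^ n
  unique-length≤ zero {[]} _ = z≤n
  unique-length≤ zero {[] ∷ []} _ = s≤s z≤n
  unique-length≤ zero {[] ∷ [] ∷ _} ((x≢y ∷ _) ∷ _) = contradiction refl x≢y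
  unique-length≤ (suc n) {L} u = begin
    length L                                          ≡⟨ halfPlane-partition fzero true L ⟨
    interCard L (fzero , true) + interCard L (fzero , not true)
                                                      ≤⟨ +-mono-≤ (filtered true) (filtered (not true)) ⟩
    2 ^ n + 2 ^ n                                     ≡⟨ cong (2 ^ n +_) (+-identityʳ (2 ^ n)) ⟨
    2 ^ suc n                                         ∎
    where
    open ≤-Reasoning
    filtered : ∀ a → interCard L (fzero , a) ≤ 2 ^ n
    filtered a = slice-length≤ fzero a (All.all-filter (inHalf? (fzero , a)) L)
                                       (Unique.filter⁺ (inHalf? (fzero , a)) u)

  slice-length≤ : ∀ {n} i a {L : List (Point (suc n))} →
    All (inHalf (i , a)) L → Unique L → length L ≤ 2 ^ n
  slice-length≤ {n} i a {L} inH u = begin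
    length L                              ≡⟨ length-map (λ x → removeAt x i) L ⟨
    length (map (λ x → removeAt x i) L)   ≤⟨ unique-length≤ n (removeAt-unique i a inH u) ⟩
    2 ^ n                                 ∎
    where open ≤-Reasoning

halfPlane-length≤ : ∀ {n} (H : HalfPlane n) {L : List (Point n)} →
  All (inHalf H) L → Unique L → 2 * length L ≤ 2 ^ n
halfPlane-length≤ {suc n} (i , a) inH u = *-monoʳ-≤ 2 (slice-length≤ i a inH u)

quarter-length≤ : ∀ {n} {i j : Fin n} {a b} {L : List (Point n)} → i ≢ j →
  All (λ x → inHalf (i , a) x × inHalf (j , b) x) L → Unique L → 4 * length L ≤ 2 ^ n
quarter-length≤ {suc n} {i} {j} {a} {b} {L} i≢j inQ u = begin
  4 * length L                                ≡⟨ *-assoc 2 2 (length L) ⟩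
  2 * (2 * length L)                          ≡⟨ cong (λ k → 2 * (2 * k)) (length-map (λ x → removeAt x i) L) ⟨
  2 * (2 * length (map (λ x → removeAt x i) L))
    ≤⟨ *-monoʳ-≤ 2 (halfPlane-length≤ (punchOut i≢j , b) inHalf′ unique′) ⟩
  2 * 2 ^ n                                   ∎
  where
  open ≤-Reasoning
  inHalf′ : All (inHalf (punchOut i≢j , b)) (map (λ x → removeAt x i) L)
  inHalf′ = All.map⁺ (All.map (λ {x} (_ , xⱼ≡b) → trans (removeAt-punchOut x i≢j) xⱼ≡b) inQ)
  unique′ : Unique (map (λ x → removeAt x i) L)
  unique′ = removeAt-unique i a (All.map proj₁ inQ) u

outside-length≤ : ∀ {n} {H H' : HalfPlane n} {L : List (Point n)} → H ≢ H' →
  All (λ x → ¬ inHalf H x × ¬ inHalf H' x) L → Unique L → 4 * length L ≤ 2 ^ n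
outside-length≤ {H = i , a} {j , b} H≢H' out u with i Fin.≟ j
... | no i≢j = quarter-length≤ i≢j (All.map (λ (xᵢ≢a , xⱼ≢b) → ¬-not xᵢ≢a , ¬-not xⱼ≢b) out) u
outside-length≤ {L = []} H≢H' [] u | yes refl = z≤n
outside-length≤ {L = x ∷ _} H≢H' ((xᵢ≢a , xᵢ≢b) ∷ _) u | yes refl =
  contradiction (cong (_ ,_) (not-injective (trans (sym (¬-not xᵢ≢a)) (¬-not xᵢ≢b)))) H≢H'

two-halfPlanes-bound : ∀ {n} {H H' : HalfPlane n} {S : List (Point n)} → H ≢ H' → Unique S →
  2 * length S ≡ 2 ^ n → 2 ^ n ≤ 4 * (interCard S H + interCard S H')
two-halfPlanes-bound {n} {H@(_ , _)} {H'@(_ , _)} {S} H≢H' u 2|S|≡2ⁿ = +-cancelʳ-≤ (2 ^ n) (2 ^ n) _ (begin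
  2 ^ n + 2 ^ n                          ≡⟨ cong (2 ^ n +_) (+-identityʳ (2 ^ n)) ⟨
  2 * 2 ^ n                              ≡⟨ cong (2 *_) 2|S|≡2ⁿ ⟨
  2 * (2 * length S)                     ≡⟨ *-assoc 2 2 (length S) ⟨
  4 * length S                           ≤⟨ *-monoʳ-≤ 4 (filter-cover (inHalf? H) (inHalf? H') S) ⟩
  4 * (interCard S H + interCard S H' + length D)
                                         ≡⟨ *-distribˡ-+ 4 (interCard S H + interCard S H') (length D) ⟩
  4 * (interCard S H + interCard S H') + 4 * length D
                                         ≤⟨ +-monoʳ-≤ _ (outside-length≤ H≢H' outsideD uniqueD) ⟩
  4 * (interCard S H + interCard S H') + 2 ^ n ∎)
  where
  open ≤-Reasoning
  D = outside H H' S
  uniqueD : Unique D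
  uniqueD = Unique.filter⁺ _ (Unique.filter⁺ _ u)
  outsideD : All (λ x → ¬ inHalf H x × ¬ inHalf H' x) D
  outsideD = All.zip (All.filter⁺ (∁? (inHalf? H')) (All.all-filter (∁? (inHalf? H)) S) ,
                      All.all-filter (∁? (inHalf? H')) (filter (∁? (inHalf? H)) S))

lemma2p3 : (n : ℕ) (S : List (Point n)) (t : ℕ) →
    Unique S → 2 * length S ≡ 2 ^ n → IsType S t → 8 * t < 2 ^ n →
    Σ (HalfPlane n) (λ H →
      interCard S H ≡ t ×
      ((H' : HalfPlane n) → interCard S H' ≡ t → H' ≡ H) ×
      ((H' : HalfPlane n) → ¬ H' ≡ H →
        (2 ^ n ≤ 4 * (interCard S H' + t)) × (2 ^ n + 8 * t < 2 * 2 ^ n)))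
lemma2p3 n S t u 2|S|≡2ⁿ ((H , |S∩H|≡t) , _) 8t<2ⁿ =
  H , |S∩H|≡t , unique , λ H' H'≢H → other-bound H' H'≢H , 2ⁿ+8t<2ⁿ⁺¹
  where
  other-bound : ∀ H' → H' ≢ H → 2 ^ n ≤ 4 * (interCard S H' + t)
  other-bound H' H'≢H = subst (λ s → 2 ^ n ≤ 4 * (interCard S H' + s)) |S∩H|≡t
                              (two-halfPlanes-bound H'≢H u 2|S|≡2ⁿ)

  unique : ∀ H' → interCard S H' ≡ t → H' ≡ H
  unique H' |S∩H'|≡t with ≡-dec Fin._≟_ _≟ᵇ_ H' H
  ... | yes H'≡H = H'≡H
  ... | no H'≢H = contradiction (begin
    2 ^ n                       ≤⟨ other-bound H' H'≢H ⟩
    4 * (interCard S H' + t)    ≡⟨ cong (λ s → 4 * (s + t)) |S∩H'|≡t ⟩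
    4 * (t + t)                 ≡⟨ *-distribˡ-+ 4 t t ⟩
    4 * t + 4 * t               ≡⟨ *-distribʳ-+ t 4 4 ⟨
    8 * t                       ∎) (<⇒≱ 8t<2ⁿ)
    where open ≤-Reasoning

  2ⁿ+8t<2ⁿ⁺¹ : 2 ^ n + 8 * t < 2 * 2 ^ n
  2ⁿ+8t<2ⁿ⁺¹ = subst (2 ^ n + 8 * t <_) (cong (2 ^ n +_) (sym (+-identityʳ (2 ^ n))))
                     (+-monoʳ-< (2 ^ n) 8t<2ⁿ)
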